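{- For every $n\in\mathbb{N}$, every isometric embedding of the unweighted cycle graph $C_{2n}$ (with its shortest-path metric) into $\ell_\infty$ requires at least $n$ coordinates. Furthermore, there is no function $\alpha:\mathbb{N}\rightarrow\mathbb{N}$ such that every cycle graph $C_n$, $n\in\mathbb{N}$, with every priority ordering of its vertices can be isometrically embedded into $\ell_\infty$ with prioritized dimension $\alpha$.
   Context: Given a priority ordering $x_1,\dots,x_m$ of the vertices, an embedding $f$ into $\ell_\infty$ has prioritized dimension $\alpha$ if $f(x_j)$ is non-zero only in its first $\alpha(j)$ coordinates. The function $\alpha$ may not depend on the graph size.
   Formalization: The embeddings of $C_{2n}$ into $\ell_\infty$ have only rational coordinates, and the embeddings excluded in the second part likewise take values in ℚ. -}

module Defs where

open import Data.Nat as ℕ using (ℕ; _⊓_; _∸_; _<_)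
open import Data.Fin using (Fin; toℕ)
open import Data.Fin.Permutation using (Permutation′; _⟨$⟩ʳ_)
open import Data.Integer using (+_)
open import Data.Rational as ℚ using (ℚ; _/_; _-_; ∣_∣; _⊔_; 0ℚ)
open import Data.List using (List; foldr; map)
open import Data.List using () renaming (allFin to allFinL)
open import Data.Product using (Σ; _×_)
open import Relation.Binary.PropositionalEquality using (_≡_)
open import Relation.Nullary using (¬_)

ℕ→ℚ : ℕ → ℚ
ℕ→ℚ n = + n / 1

absDiff : ℕ → ℕ → ℕ
absDiff a b = (a ∸ b) ℕ.⊔ (b ∸ a)

-- shortest-path metric of the unweighted cycle C_m on vertices Fin m
-- (vertex i adjacent to i±1 mod m)
cycleDist : (m : ℕ) → Fin m → Fin m → ℕ
cycleDist m i j = absDiff (toℕ i) (toℕ j) ⊓ (m ∸ absDiff (toℕ i) (toℕ j))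

-- ℓ∞ distance in ℚ^d : max over coordinates (0 for d = 0)
dist∞ : (d : ℕ) → (Fin d → ℚ) → (Fin d → ℚ) → ℚ
dist∞ d u v = foldr _⊔_ 0ℚ (map (λ i → ∣ u i - v i ∣) (allFinL d))

IsometricCycleEmbedding : (m d : ℕ) → (Fin m → Fin d → ℚ) → Set
IsometricCycleEmbedding m d f =
  ∀ x y → dist∞ d (f x) (f y) ≡ ℕ→ℚ (cycleDist m x y)

-- Points of ℓ∞ as sequences ℕ → ℚ. f : Fin m → (ℕ → ℚ) is isometric
-- (for the metric of C_m) when the sup of |f x k - f y k| over k equals
-- the cycle distance; for finitely supported sequences (which is forced by
-- prioritized dimension) the sup is attained, so it is written out as
-- "all coordinates bounded, some coordinate attains".
IsometricCycleEmbedding∞ : (m : ℕ) → (Fin m → ℕ → ℚ) → Set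
IsometricCycleEmbedding∞ m f =
  (∀ x y k → ∣ f x k - f y k ∣ ℚ.≤ ℕ→ℚ (cycleDist m x y)) ×
  (∀ x y → Σ ℕ λ k → ∣ f x k - f y k ∣ ≡ ℕ→ℚ (cycleDist m x y))

-- Priority ordering x_1,…,x_m given by π : x_{j+1} = π (j) for j : Fin m
-- (0-based index j corresponds to priority j+1).
-- f has prioritized dimension α: f(x_j) is nonzero only in its first α(j)
-- coordinates (coordinates indexed 0,1,2,…).
HasPrioritizedDimension : (m : ℕ) → (α : ℕ → ℕ) → Permutation′ m →
                          (Fin m → ℕ → ℚ) → Set
HasPrioritizedDimension m α π f =
  ∀ (j : Fin m) (k : ℕ) → ¬ (f (π ⟨$⟩ʳ j) k ≡ 0ℚ) → k < α (ℕ.suc (toℕ j))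

{-# OPTIONS --safe #-}
module Submission where

-- Fix an antipodal pair {i, i + n} of C₂ₙ. Every vertex lies on a geodesic between i and
-- i + n, so a 1-Lipschitz coordinate g with |g i − g (i + n)| = n must equal g c − d(c, ·),
-- where c is the endpoint at which g is larger. This c is determined by g, hence an isometric
-- embedding needs a separate coordinate for each of the n antipodal pairs. Moreover such a g
-- takes different values at adjacent vertices, C₂ₙ being bipartite. If x₁ and x₂ are adjacent
-- and supported in the first max(α 1, α 2) coordinates, all these n coordinates lie there,
-- which fails for n > max(α 1, α 2).

open import Data.Nat using (ℕ; zero; suc; _+_; _*_; _∸_; _⊔_; _⊓_; _≤_; _<_; _≤?_)
open import Data.Nat.Properties
import Data.Nat as ℕ
import Data.Integer as ℤ
import Data.Integer.Properties as ℤ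
open import Data.Rational as ℚ using (ℚ; mkℚ; _-_; -_; ∣_∣; 0ℚ)
import Data.Rational.Properties as ℚ
open import Data.Rational.Solver using (module +-*-Solver)
import Data.Nat.Coprimality as Coprimality
open import Data.Fin using (Fin; toℕ; fromℕ<; _↑ˡ_; _↑ʳ_; splitAt)
open import Data.Fin.Properties
  using (toℕ-↑ˡ; toℕ-↑ʳ; ↑ˡ-injective; ↑ʳ-injective; splitAt-↑ˡ; splitAt-↑ʳ; toℕ-injective; toℕ<n; toℕ-fromℕ<; ¬Fin0; injective⇒≤)
open import Data.Fin.Permutation using (Permutation′)
import Data.Fin.Permutation as Permutation
import Data.Fin as Fin
open import Data.List using (map; allFin)
open import Data.List.Properties using (foldr-preservesᵒ)
open import Data.List.Membership.Propositional.Properties using (∈-map⁺; ∈-map⁻; ∈-allFin; foldr-selective)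
import Data.List.Relation.Unary.Any as Any
open import Data.Product using (Σ; _×_; _,_; proj₁; proj₂; map₂)
open import Data.Sum using (_⊎_; inj₁; inj₂; [_,_]′)
open import Function using (Injective)
open import Relation.Binary.PropositionalEquality
  using (_≡_; _≢_; refl; sym; trans; cong; cong₂; subst; module ≡-Reasoning)
open import Relation.Nullary using (¬_; yes; no; contradiction)
open import Defs

ℕ→ℚ≡mkℚ : ∀ n → ℕ→ℚ n ≡ mkℚ (ℤ.+ n) 0 (Coprimality.sym (Coprimality.1-coprimeTo n))
ℕ→ℚ≡mkℚ n = ℚ.normalize-coprime (Coprimality.sym (Coprimality.1-coprimeTo n))

ℕ→ℚ-injective : ∀ {a b} → ℕ→ℚ a ≡ ℕ→ℚ b → a ≡ b
ℕ→ℚ-injective {a} {b} e = cong (λ q → ℤ.∣ ℚ.↥ q ∣) (trans (sym (ℕ→ℚ≡mkℚ a)) (trans e (ℕ→ℚ≡mkℚ b)))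

ℕ→ℚ-homo-+ : ∀ a b → ℕ→ℚ (a + b) ≡ ℕ→ℚ a ℚ.+ ℕ→ℚ b
ℕ→ℚ-homo-+ a b rewrite ℕ→ℚ≡mkℚ a | ℕ→ℚ≡mkℚ b =
  sym (cong (ℚ._/ 1) (cong₂ ℤ._+_ (ℤ.*-identityʳ (ℤ.+ a)) (ℤ.*-identityʳ (ℤ.+ b))))

p≤∣p∣ : ∀ p → p ℚ.≤ ∣ p ∣
p≤∣p∣ (mkℚ (ℤ.+ n) d c) = ℚ.≤-refl
p≤∣p∣ p@(mkℚ ℤ.-[1+ n ] d c) = ℚ.≤-trans (ℚ.<⇒≤ (ℚ.negative⁻¹ p)) (ℚ.0≤∣p∣ p)

p≤q⇒r≤s⇒p+r≡q+s⇒p≡q : ∀ {p q r s} → p ℚ.≤ q → r ℚ.≤ s → p ℚ.+ r ≡ q ℚ.+ s → p ≡ q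
p≤q⇒r≤s⇒p+r≡q+s⇒p≡q p≤q r≤s e =
  ℚ.≤-antisym p≤q (ℚ.≮⇒≥ (λ p<q → ℚ.<-irrefl e (ℚ.+-mono-<-≤ p<q r≤s)))

module _ where
  open +-*-Solver

  [p-q]+[q-r]≡p-r : ∀ p q r → (p - q) ℚ.+ (q - r) ≡ p - r
  [p-q]+[q-r]≡p-r = solve 3 (λ p q r → (p :- q) :+ (q :- r) := p :- r) refl

  q-p≡-[p-q] : ∀ p q → q - p ≡ - (p - q)
  q-p≡-[p-q] = solve 2 (λ p q → q :- p := :- (p :- q)) refl

coordinate≤dist∞ : ∀ {d} (u v : Fin d → ℚ) k → ∣ u k - v k ∣ ℚ.≤ dist∞ d u v
coordinate≤dist∞ u v k = foldr-preservesᵒ bound 0ℚ _ (inj₂ (Any.map ℚ.≤-reflexive (∈-map⁺ _ (∈-allFin k))))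
  where
  bound : ∀ p q → ∣ u k - v k ∣ ℚ.≤ p ⊎ ∣ u k - v k ∣ ℚ.≤ q → ∣ u k - v k ∣ ℚ.≤ p ℚ.⊔ q
  bound p q = [ (λ h → ℚ.≤-trans h (ℚ.p≤p⊔q p q)) , (λ h → ℚ.≤-trans h (ℚ.p≤q⊔p p q)) ]′

dist∞-attained : ∀ {d} (u v : Fin d → ℚ) →
                 dist∞ d u v ≡ 0ℚ ⊎ Σ (Fin d) λ k → ∣ u k - v k ∣ ≡ dist∞ d u v
dist∞-attained {d} u v with foldr-selective ℚ.⊔-sel 0ℚ (map (λ k → ∣ u k - v k ∣) (allFin d))
... | inj₁ e = inj₁ e
... | inj₂ m with ∈-map⁻ (λ k → ∣ u k - v k ∣) m
...   | k , _ , e = inj₂ (k , sym e)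

arc : ℕ → ℕ → ℕ
arc m u = u ⊓ (m ∸ u)

absDiff≡∣-∣ : ∀ a b → absDiff a b ≡ ℕ.∣ a - b ∣
absDiff≡∣-∣ a b with ≤-total a b
... | inj₁ a≤b = trans (cong (_⊔ (b ∸ a)) (m≤n⇒m∸n≡0 a≤b)) (sym (m≤n⇒∣m-n∣≡n∸m a≤b))
... | inj₂ b≤a = trans (cong ((a ∸ b) ⊔_) (m≤n⇒m∸n≡0 b≤a))
                       (trans (⊔-identityʳ (a ∸ b)) (sym (m≤n⇒∣n-m∣≡n∸m b≤a)))

cycleDist≡arc : ∀ m (x y : Fin m) → cycleDist m x y ≡ arc m ℕ.∣ toℕ x - toℕ y ∣
cycleDist≡arc m x y = cong (λ u → u ⊓ (m ∸ u)) (absDiff≡∣-∣ (toℕ x) (toℕ y))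

∣m-n∣<o : ∀ {m n o} → m < o → n < o → ℕ.∣ m - n ∣ < o
∣m-n∣<o {m} {n} m<o n<o = ≤-<-trans (∣m-n∣≤m⊔n m n) (⊔-lub m<o n<o)

2*n∸[n+p]≡n∸p : ∀ n p → 2 * n ∸ (n + p) ≡ n ∸ p
2*n∸[n+p]≡n∸p n p = trans ([m+n]∸[m+o]≡n∸o n (n + 0) p) (cong (_∸ p) (+-identityʳ n))

arc-short : ∀ {n p} → p ≤ n → arc (2 * n) p ≡ p
arc-short {n} {p} p≤n = m≤n⇒m⊓n≡m (begin
  p                 ≤⟨ p≤n ⟩
  n                 ≡⟨ 2*n∸[n+p]≡n∸p n 0 ⟨
  2 * n ∸ (n + 0)   ≤⟨ ∸-monoʳ-≤ (2 * n) (≤-trans p≤n (m≤m+n n 0)) ⟩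
  2 * n ∸ p         ∎)
  where open ≤-Reasoning

arc-long : ∀ n p → arc (2 * n) (n + p) ≡ n ∸ p
arc-long n p = trans (cong ((n + p) ⊓_) (2*n∸[n+p]≡n∸p n p))
                     (m≥n⇒m⊓n≡n (≤-trans (m∸n≤m n p) (m≤m+n n p)))

arc≡0⇒≡0 : ∀ {m u} → u < m → arc m u ≡ 0 → u ≡ 0
arc≡0⇒≡0 {m} {u} u<m e with ⊓-sel u (m ∸ u)
... | inj₁ e′ = trans (sym e′) e
... | inj₂ e′ = contradiction (m∸n≡0⇒m≤n (trans (sym e′) e)) (<⇒≱ u<m)

arc-suc≢ : ∀ {n u} → suc u < 2 * n → arc (2 * n) (suc u) ≢ arc (2 * n) u
arc-suc≢ {n} {u} su<2n e with suc u ≤? n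
... | yes su≤n = 1+n≢n (trans (sym (arc-short su≤n)) (trans e (arc-short (≤-trans (n≤1+n u) su≤n))))
... | no su≰n = 1+n≢n (∸-cancelˡ-≡ 1+r≤n (≤-trans (n≤1+n r) 1+r≤n) n∸1+r≡n∸r)
  where
  r = u ∸ n
  n+r≡u : n + r ≡ u
  n+r≡u = m+[n∸m]≡n (≤-pred (≰⇒> su≰n))
  1+r≤n : suc r ≤ n
  1+r≤n = +-cancelˡ-≤ n (suc r) n (begin
    n + suc r   ≡⟨ trans (+-suc n r) (cong suc n+r≡u) ⟩
    suc u       ≤⟨ <⇒≤ su<2n ⟩
    2 * n       ≡⟨ cong (n +_) (+-identityʳ n) ⟩
    n + n       ∎)
    where open ≤-Reasoning
  n∸1+r≡n∸r : n ∸ suc r ≡ n ∸ r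
  n∸1+r≡n∸r = begin
    n ∸ suc r                 ≡⟨ arc-long n (suc r) ⟨
    arc (2 * n) (n + suc r)   ≡⟨ cong (arc (2 * n)) (trans (+-suc n r) (cong suc n+r≡u)) ⟩
    arc (2 * n) (suc u)       ≡⟨ e ⟩
    arc (2 * n) u             ≡⟨ cong (arc (2 * n)) n+r≡u ⟨
    arc (2 * n) (n + r)       ≡⟨ arc-long n r ⟩
    n ∸ r                     ∎
    where open ≡-Reasoning

∣m-n∣-adjacent : ∀ m n → ℕ.∣ m - n ∣ ≡ suc ℕ.∣ m - suc n ∣ ⊎ ℕ.∣ m - suc n ∣ ≡ suc ℕ.∣ m - n ∣
∣m-n∣-adjacent zero    n       = inj₂ refl
∣m-n∣-adjacent (suc m) zero    = inj₁ (cong suc (sym (∣-∣-identityʳ m)))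
∣m-n∣-adjacent (suc m) (suc n) = ∣m-n∣-adjacent m n

arc-adjacent≢ : ∀ {n c v} → c < 2 * n → suc v < 2 * n →
                arc (2 * n) ℕ.∣ c - v ∣ ≢ arc (2 * n) ℕ.∣ c - suc v ∣
arc-adjacent≢ {n} {c} {v} c<2n sv<2n with ∣m-n∣-adjacent c v
... | inj₁ e = λ eq → arc-suc≢ {n} (subst (_< 2 * n) e (∣m-n∣<o c<2n (<⇒≤ sv<2n)))
                                (trans (cong (arc (2 * n)) (sym e)) eq)
... | inj₂ e = λ eq → arc-suc≢ {n} (subst (_< 2 * n) e (∣m-n∣<o c<2n sv<2n))
                                (trans (cong (arc (2 * n)) (sym e)) (sym eq))

arc-between-antipodes : ∀ {n a x} → a < n → x < 2 * n →
                        arc (2 * n) ℕ.∣ a - x ∣ + arc (2 * n) ℕ.∣ x - (n + a) ∣ ≡ n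
arc-between-antipodes {n} {a} {x} a<n x<2n with x ≤? a | x ≤? n + a
... | yes x≤a | _ = begin
  arc (2 * n) ℕ.∣ a - x ∣ + arc (2 * n) ℕ.∣ x - (n + a) ∣
    ≡⟨ cong₂ (λ p q → arc (2 * n) p + arc (2 * n) q)
             (m≤n⇒∣n-m∣≡n∸m x≤a)
             (trans (m≤n⇒∣m-n∣≡n∸m (≤-trans x≤a (m≤n+m a n))) (+-∸-assoc n x≤a)) ⟩
  arc (2 * n) (a ∸ x) + arc (2 * n) (n + (a ∸ x))
    ≡⟨ cong₂ _+_ (arc-short (≤-trans (m∸n≤m a x) (<⇒≤ a<n))) (arc-long n (a ∸ x)) ⟩
  (a ∸ x) + (n ∸ (a ∸ x))
    ≡⟨ m+[n∸m]≡n (≤-trans (m∸n≤m a x) (<⇒≤ a<n)) ⟩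
  n ∎
  where open ≡-Reasoning
... | no x≰a | yes x≤n+a = begin
  arc (2 * n) ℕ.∣ a - x ∣ + arc (2 * n) ℕ.∣ x - (n + a) ∣
    ≡⟨ cong₂ (λ p q → arc (2 * n) p + arc (2 * n) q)
             (m≤n⇒∣m-n∣≡n∸m a≤x) (trans (m≤n⇒∣m-n∣≡n∸m x≤n+a) n+a∸x≡n∸[x∸a]) ⟩
  arc (2 * n) (x ∸ a) + arc (2 * n) (n ∸ (x ∸ a))
    ≡⟨ cong₂ _+_ (arc-short x∸a≤n) (arc-short (m∸n≤m n (x ∸ a))) ⟩
  (x ∸ a) + (n ∸ (x ∸ a))
    ≡⟨ m+[n∸m]≡n x∸a≤n ⟩
  n ∎
  where
  open ≡-Reasoning
  a≤x : a ≤ x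
  a≤x = <⇒≤ (≰⇒> x≰a)
  x∸a≤n : x ∸ a ≤ n
  x∸a≤n = m≤n+o⇒m∸n≤o x a (subst (x ≤_) (+-comm n a) x≤n+a)
  n+a∸x≡n∸[x∸a] : n + a ∸ x ≡ n ∸ (x ∸ a)
  n+a∸x≡n∸[x∸a] = begin
    n + a ∸ x              ≡⟨ cong (n + a ∸_) (m+[n∸m]≡n a≤x) ⟨
    n + a ∸ (a + (x ∸ a))  ≡⟨ cong (_∸ (a + (x ∸ a))) (+-comm n a) ⟩
    a + n ∸ (a + (x ∸ a))  ≡⟨ [m+n]∸[m+o]≡n∸o a n (x ∸ a) ⟩
    n ∸ (x ∸ a)            ∎
... | no x≰a | no x≰n+a = begin
  arc (2 * n) ℕ.∣ a - x ∣ + arc (2 * n) ℕ.∣ x - (n + a) ∣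
    ≡⟨ cong₂ (λ p q → arc (2 * n) p + arc (2 * n) q)
             (trans (m≤n⇒∣m-n∣≡n∸m a≤x) x∸a≡n+r) (m≤n⇒∣n-m∣≡n∸m n+a≤x) ⟩
  arc (2 * n) (n + r) + arc (2 * n) r
    ≡⟨ cong₂ _+_ (arc-long n r) (arc-short r≤n) ⟩
  (n ∸ r) + r
    ≡⟨ m∸n+n≡m r≤n ⟩
  n ∎
  where
  open ≡-Reasoning
  r = x ∸ (n + a)
  a≤x : a ≤ x
  a≤x = <⇒≤ (≰⇒> x≰a)
  n+a≤x : n + a ≤ x
  n+a≤x = <⇒≤ (≰⇒> x≰n+a)
  r≤n : r ≤ n
  r≤n = ≤-trans (∸-monoʳ-≤ x (m≤m+n n a))
                (m≤n+o⇒m∸n≤o x n (subst (x ≤_) (cong (n +_) (+-identityʳ n)) (<⇒≤ x<2n)))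
  x∸a≡n+r : x ∸ a ≡ n + r
  x∸a≡n+r = begin
    x ∸ a            ≡⟨ m+[n∸m]≡n (m+n≤o⇒m≤o∸n n n+a≤x) ⟨
    n + (x ∸ a ∸ n)  ≡⟨ cong (n +_) (∸-+-assoc x a n) ⟩
    n + (x ∸ (a + n)) ≡⟨ cong (λ k → n + (x ∸ k)) (+-comm a n) ⟩
    n + r            ∎

cycleDist-refl : ∀ m (x : Fin m) → cycleDist m x x ≡ 0
cycleDist-refl m x = trans (cycleDist≡arc m x x) (cong (arc m) (∣n-n∣≡0 (toℕ x)))

cycleDist-sym : ∀ m (x y : Fin m) → cycleDist m x y ≡ cycleDist m y x
cycleDist-sym m x y = cong (λ u → u ⊓ (m ∸ u)) (⊔-comm (toℕ x ∸ toℕ y) (toℕ y ∸ toℕ x))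

cycleDist≡0⇒≡ : ∀ m (x y : Fin m) → cycleDist m x y ≡ 0 → x ≡ y
cycleDist≡0⇒≡ m x y e = toℕ-injective (∣m-n∣≡0⇒m≡n
  (arc≡0⇒≡0 (∣m-n∣<o (toℕ<n x) (toℕ<n y)) (trans (sym (cycleDist≡arc m x y)) e)))

cycleDist-adjacent≢ : ∀ {n} (c v w : Fin (2 * n)) → toℕ w ≡ suc (toℕ v) →
                      cycleDist (2 * n) c v ≢ cycleDist (2 * n) c w
cycleDist-adjacent≢ {n} c v w w≡1+v e =
  arc-adjacent≢ {n} (toℕ<n c) (subst (_< 2 * n) w≡1+v (toℕ<n w)) (begin
    arc (2 * n) ℕ.∣ toℕ c - toℕ v ∣       ≡⟨ cycleDist≡arc (2 * n) c v ⟨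
    cycleDist (2 * n) c v                 ≡⟨ e ⟩
    cycleDist (2 * n) c w                 ≡⟨ cycleDist≡arc (2 * n) c w ⟩
    arc (2 * n) ℕ.∣ toℕ c - toℕ w ∣       ≡⟨ cong (λ k → arc (2 * n) ℕ.∣ toℕ c - k ∣) w≡1+v ⟩
    arc (2 * n) ℕ.∣ toℕ c - suc (toℕ v) ∣ ∎)
  where open ≡-Reasoning

module _ {n : ℕ} where

  lower upper : Fin n → Fin (2 * n)
  lower i = i ↑ˡ (n + 0)
  upper i = n ↑ʳ (i ↑ˡ 0)

  toℕ-upper : ∀ i → toℕ (upper i) ≡ n + toℕ i
  toℕ-upper i = trans (toℕ-↑ʳ n (i ↑ˡ 0)) (cong (n +_) (toℕ-↑ˡ i 0))

  _∈Pair_ : Fin (2 * n) → Fin n → Set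
  c ∈Pair i = c ≡ lower i ⊎ c ≡ upper i

  lower≢upper : ∀ i j → lower i ≢ upper j
  lower≢upper i j e
    with trans (sym (splitAt-↑ˡ n i (n + 0))) (trans (cong (splitAt n) e) (splitAt-↑ʳ n (n + 0) (j ↑ˡ 0)))
  ... | ()

  ∈Pair-unique : ∀ {c i j} → c ∈Pair i → c ∈Pair j → i ≡ j
  ∈Pair-unique {i = i} {j} (inj₁ refl) (inj₁ e) = ↑ˡ-injective (n + 0) i j e
  ∈Pair-unique {i = i} {j} (inj₂ refl) (inj₂ e) = ↑ˡ-injective 0 i j (↑ʳ-injective n _ _ e)
  ∈Pair-unique {i = i} {j} (inj₁ refl) (inj₂ e) = contradiction e (lower≢upper i j)
  ∈Pair-unique {i = i} {j} (inj₂ refl) (inj₁ e) = contradiction (sym e) (lower≢upper j i)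

  cycleDist-between-antipodes : ∀ i z → cycleDist (2 * n) (lower i) z + cycleDist (2 * n) z (upper i) ≡ n
  cycleDist-between-antipodes i z = begin
    cycleDist (2 * n) (lower i) z + cycleDist (2 * n) z (upper i)
      ≡⟨ cong₂ _+_ (cycleDist≡arc (2 * n) (lower i) z) (cycleDist≡arc (2 * n) z (upper i)) ⟩
    arc (2 * n) ℕ.∣ toℕ (lower i) - toℕ z ∣ + arc (2 * n) ℕ.∣ toℕ z - toℕ (upper i) ∣
      ≡⟨ cong₂ (λ a b → arc (2 * n) ℕ.∣ a - toℕ z ∣ + arc (2 * n) ℕ.∣ toℕ z - b ∣)
               (toℕ-↑ˡ i (n + 0)) (toℕ-upper i) ⟩
    arc (2 * n) ℕ.∣ toℕ i - toℕ z ∣ + arc (2 * n) ℕ.∣ toℕ z - (n + toℕ i) ∣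
      ≡⟨ arc-between-antipodes (toℕ<n i) (toℕ<n z) ⟩
    n ∎
    where open ≡-Reasoning

  cycleDist-antipodes : ∀ i → cycleDist (2 * n) (lower i) (upper i) ≡ n
  cycleDist-antipodes i = begin
    cycleDist (2 * n) (lower i) (upper i)
      ≡⟨ cong (_+ cycleDist (2 * n) (lower i) (upper i)) (cycleDist-refl (2 * n) (lower i)) ⟨
    cycleDist (2 * n) (lower i) (lower i) + cycleDist (2 * n) (lower i) (upper i)
      ≡⟨ cycleDist-between-antipodes i (lower i) ⟩
    n ∎
    where open ≡-Reasoning

module _ {V : Set} (d : V → V → ℕ) where

  Lipschitz : (V → ℚ) → Set
  Lipschitz g = ∀ x y → ∣ g x - g y ∣ ℚ.≤ ℕ→ℚ (d x y)

  PeaksAt : (V → ℚ) → V → Set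
  PeaksAt g c = ∀ x → g c - g x ≡ ℕ→ℚ (d c x)

  peaksAt-tight : ∀ g {x y D} → Lipschitz g → (∀ z → d x z + d z y ≡ D) →
                  g x - g y ≡ ℕ→ℚ D → PeaksAt g x
  peaksAt-tight g {x} {y} {D} lip between gx-gy≡D z =
    p≤q⇒r≤s⇒p+r≡q+s⇒p≡q (bound x z) (bound z y) (begin
      (g x - g z) ℚ.+ (g z - g y)       ≡⟨ [p-q]+[q-r]≡p-r (g x) (g z) (g y) ⟩
      g x - g y                         ≡⟨ gx-gy≡D ⟩
      ℕ→ℚ D                             ≡⟨ cong ℕ→ℚ (between z) ⟨
      ℕ→ℚ (d x z + d z y)               ≡⟨ ℕ→ℚ-homo-+ (d x z) (d z y) ⟩
      ℕ→ℚ (d x z) ℚ.+ ℕ→ℚ (d z y)       ∎)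
    where
    open ≡-Reasoning
    bound : ∀ u v → g u - g v ℚ.≤ ℕ→ℚ (d u v)
    bound u v = ℚ.≤-trans (p≤∣p∣ (g u - g v)) (lip u v)

  peaksAt-unique : (∀ x y → d x y ≡ 0 → x ≡ y) →
                   ∀ g {c c′} → PeaksAt g c → PeaksAt g c′ → c ≡ c′
  peaksAt-unique separated g {c} {c′} peak peak′ =
    separated c c′ (m+n≡0⇒m≡0 (d c c′) (ℕ→ℚ-injective (begin
      ℕ→ℚ (d c c′ + d c′ c)               ≡⟨ ℕ→ℚ-homo-+ (d c c′) (d c′ c) ⟩
      ℕ→ℚ (d c c′) ℚ.+ ℕ→ℚ (d c′ c)       ≡⟨ cong₂ ℚ._+_ (peak c′) (peak′ c) ⟨
      (g c - g c′) ℚ.+ (g c′ - g c)       ≡⟨ [p-q]+[q-r]≡p-r (g c) (g c′) (g c) ⟩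
      g c - g c                           ≡⟨ ℚ.+-inverseʳ (g c) ⟩
      0ℚ                                  ∎)))
    where open ≡-Reasoning

  peaksAt-separates : ∀ g {c x y} → PeaksAt g c → d c x ≢ d c y → g x ≢ g y
  peaksAt-separates g {c} {x} {y} peak dx≢dy gx≡gy =
    dx≢dy (ℕ→ℚ-injective (trans (sym (peak x)) (trans (cong (λ q → g c - q) gx≡gy) (peak y))))

module _ {n : ℕ} where

  Realises : (Fin (2 * n) → ℚ) → Fin n → Set
  Realises g i = ∣ g (lower i) - g (upper i) ∣ ≡ ℕ→ℚ n

  realises⇒peak : ∀ g {i} → Lipschitz (cycleDist (2 * n)) g → Realises g i →
                 Σ (Fin (2 * n)) λ c → c ∈Pair i × PeaksAt (cycleDist (2 * n)) g c
  realises⇒peak g {i} lip realises =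
    [ lowerPeaks , upperPeaks ]′ (ℚ.∣p∣≡p∨∣p∣≡-p (g (lower i) - g (upper i)))
    where
    lowerPeaks : ∣ g (lower i) - g (upper i) ∣ ≡ g (lower i) - g (upper i) →
                 Σ (Fin (2 * n)) λ c → c ∈Pair i × PeaksAt (cycleDist (2 * n)) g c
    lowerPeaks e = lower i , inj₁ refl ,
      peaksAt-tight (cycleDist (2 * n)) g {lower i} {upper i} {n} lip
        (cycleDist-between-antipodes i) (trans (sym e) realises)
    between : ∀ z → cycleDist (2 * n) (upper i) z + cycleDist (2 * n) z (lower i) ≡ n
    between z = trans (cong₂ _+_ (cycleDist-sym (2 * n) (upper i) z) (cycleDist-sym (2 * n) z (lower i)))
                      (trans (+-comm (cycleDist (2 * n) z (upper i)) _) (cycleDist-between-antipodes i z))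
    upperPeaks : ∣ g (lower i) - g (upper i) ∣ ≡ - (g (lower i) - g (upper i)) →
                 Σ (Fin (2 * n)) λ c → c ∈Pair i × PeaksAt (cycleDist (2 * n)) g c
    upperPeaks e = upper i , inj₂ refl ,
      peaksAt-tight (cycleDist (2 * n)) g {upper i} {lower i} {n} lip between
        (trans (q-p≡-[p-q] (g (lower i)) (g (upper i))) (trans (sym e) realises))

  realises-unique : ∀ g {i j} → Lipschitz (cycleDist (2 * n)) g → Realises g i → Realises g j → i ≡ j
  realises-unique g {i} {j} lip realises-i realises-j =
    let c , c∈i , peak = realises⇒peak g lip realises-i
        c′ , c′∈j , peak′ = realises⇒peak g lip realises-j
        c≡c′ = peaksAt-unique (cycleDist (2 * n)) (cycleDist≡0⇒≡ (2 * n)) g peak peak′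
    in ∈Pair-unique c∈i (subst (_∈Pair j) (sym c≡c′) c′∈j)

  realises-separates-adjacent : ∀ g {i} → Lipschitz (cycleDist (2 * n)) g → Realises g i →
                               ∀ v w → toℕ w ≡ suc (toℕ v) → g v ≢ g w
  realises-separates-adjacent g lip realises v w w≡1+v =
    let c , _ , peak = realises⇒peak g lip realises
    in peaksAt-separates (cycleDist (2 * n)) g peak (cycleDist-adjacent≢ {n} c v w w≡1+v)

module _ {n : ℕ} {K : Set} (f : Fin (2 * n) → K → ℚ)
         (lipschitz : ∀ k → Lipschitz (cycleDist (2 * n)) (λ x → f x k))
         (attained : (i : Fin n) → Σ K λ k → Realises (λ x → f x k) i) where

  antipodalCoordinate : Fin n → K
  antipodalCoordinate i = proj₁ (attained i)

  antipodalCoordinate-injective : Injective _≡_ _≡_ antipodalCoordinate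
  antipodalCoordinate-injective {i} {j} kᵢ≡kⱼ =
    realises-unique (λ x → f x k) (lipschitz k)
      (subst (λ k′ → Realises (λ x → f x k′) i) kᵢ≡kⱼ (proj₂ (attained i))) (proj₂ (attained j))
    where k = antipodalCoordinate j

isometricCycleEmbedding-dimension : (n d : ℕ) (f : Fin (2 * n) → Fin d → ℚ) →
                                    IsometricCycleEmbedding (2 * n) d f → n ≤ d
isometricCycleEmbedding-dimension n d f isometric =
  injective⇒≤ (antipodalCoordinate-injective {n} f lipschitz attained)
  where
  lipschitz : ∀ k → Lipschitz (cycleDist (2 * n)) (λ x → f x k)
  lipschitz k x y = ℚ.≤-trans (coordinate≤dist∞ (f x) (f y) k) (ℚ.≤-reflexive (isometric x y))
  dist≡n : ∀ i → dist∞ d (f (lower i)) (f (upper i)) ≡ ℕ→ℚ n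
  dist≡n i = trans (isometric (lower i) (upper i)) (cong ℕ→ℚ (cycleDist-antipodes i))
  attained : ∀ i → Σ (Fin d) λ k → Realises (λ x → f x k) i
  attained i =
    [ (λ dist≡0 → contradiction (subst Fin (ℕ→ℚ-injective (trans (sym (dist≡n i)) dist≡0)) i) ¬Fin0)
    , map₂ (λ e → trans e (dist≡n i)) ]′
    (dist∞-attained (f (lower i)) (f (upper i)))

p≢q⇒p≢0⊎q≢0 : ∀ {p q} → p ≢ q → p ≢ 0ℚ ⊎ q ≢ 0ℚ
p≢q⇒p≢0⊎q≢0 {p} {q} p≢q with p ℚ.≟ 0ℚ
... | no p≢0 = inj₁ p≢0
... | yes p≡0 = inj₂ (λ q≡0 → p≢q (trans p≡0 (sym q≡0)))

isometricCycleEmbedding∞-adjacent-support :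
  ∀ n (f : Fin (2 * n) → ℕ → ℚ) → IsometricCycleEmbedding∞ (2 * n) f →
  ∀ {B} v w → toℕ w ≡ suc (toℕ v) →
  (∀ k → f v k ≢ 0ℚ → k < B) → (∀ k → f w k ≢ 0ℚ → k < B) → n ≤ B
isometricCycleEmbedding∞-adjacent-support n f (bounded , attainedAt) {B} v w w≡1+v supp-v supp-w =
  injective⇒≤ {f = λ i → fromℕ< (k<B i)} λ {i} {j} e →
    antipodalCoordinate-injective {n} f lipschitz attained
      (trans (sym (toℕ-fromℕ< (k<B i))) (trans (cong toℕ e) (toℕ-fromℕ< (k<B j))))
  where
  lipschitz : ∀ k → Lipschitz (cycleDist (2 * n)) (λ x → f x k)
  lipschitz k x y = bounded x y k
  attained : ∀ i → Σ ℕ λ k → Realises (λ x → f x k) i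
  attained i = map₂ (λ e → trans e (cong ℕ→ℚ (cycleDist-antipodes i))) (attainedAt (lower i) (upper i))
  k<B : ∀ i → antipodalCoordinate {n} f lipschitz attained i < B
  k<B i = [ supp-v k , supp-w k ]′ (p≢q⇒p≢0⊎q≢0
    (realises-separates-adjacent {n} (λ x → f x k) (lipschitz k) (proj₂ (attained i)) v w w≡1+v))
    where k = antipodalCoordinate {n} f lipschitz attained i

noPrioritizedDimension : ¬ (Σ (ℕ → ℕ) λ α →
  (m : ℕ) → 3 ≤ m → (π : Permutation′ m) →
  Σ (Fin m → ℕ → ℚ) λ f → HasPrioritizedDimension m α π f × IsometricCycleEmbedding∞ m f)
noPrioritizedDimension (α , embed) =
  let f , prioritized , isometric = embed (2 * (2 + B)) 3≤2*[2+B] Permutation.id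
  in 1+n≰n (≤-trans (n≤1+n (suc B))
       (isometricCycleEmbedding∞-adjacent-support (2 + B) f isometric Fin.zero (Fin.suc Fin.zero) refl
         (λ k fk≢0 → ≤-trans (prioritized Fin.zero k fk≢0) (m≤m⊔n (α 1) (α 2)))
         (λ k fk≢0 → ≤-trans (prioritized (Fin.suc Fin.zero) k fk≢0) (m≤n⊔m (α 1) (α 2)))))
  where
  -- With n = 2 + B the type Fin (2 * n) reduces to Fin (suc (suc _)), so x₁ = 0 and x₂ = 1 exist.
  B = α 1 ⊔ α 2
  3≤2*[2+B] : 3 ≤ 2 * (2 + B)
  3≤2*[2+B] = ≤-trans (n≤1+n 3) (*-monoʳ-≤ 2 (m≤m+n 2 B))

theorem5p1 :
  ((n d : ℕ) (f : Fin (2 * n) → Fin d → ℚ) →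
    IsometricCycleEmbedding (2 * n) d f → n ≤ d)
  ×
  ¬ (Σ (ℕ → ℕ) λ α →
      (m : ℕ) → 3 ≤ m → (π : Permutation′ m) →
        Σ (Fin m → ℕ → ℚ) λ f →
          HasPrioritizedDimension m α π f × IsometricCycleEmbedding∞ m f)
theorem5p1 = isometricCycleEmbedding-dimension , noPrioritizedDimension
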